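{- Let $D$ be a diagram with $|G(D)|=0$. If $D_0,D_1,D_2,D_3\in\mathrm{GKD}(D)$ with $D_1\neq D_2$ satisfy: $D_0$ covers $D_1$ and $D_2$, and $D_1$ and $D_2$ both cover $D_3$, in $\mathcal{P}_G(D)$, then $D_3$ is the meet $D_1\wedge D_2$ in $\mathcal{P}_G(D)$.
   Context: A diagram is a finite set of cells placed at positions $(r,c)\in\mathbb{Z}_{>0}\times\mathbb{Z}_{>0}$ ($r$ the row, counted from the bottom; $c$ the column), each position holding at most one cell; each cell is either an ordinary cell, written $(r,c)$, or a ghost cell, written $\langle r,c\rangle$. A position is empty if it holds no cell of either kind. $G(D)$ denotes the set of ghost cells of $D$. The ghost move at row $r$ of $D$, with result denoted $\mathcal{G}(D,r)$, is defined as follows: if row $r$ is empty, $\mathcal{G}(D,r)=D$. Otherwise let $c$ be the largest column of a cell in row $r$. If this rightmost cell is a ghost cell, or there is no empty position $(\hat r,c)$ with $\hat r<r$, or, letting $\hat r<r$ be maximal with $(\hat r,c)$ empty, there is a ghost cell $\langle r^*,c\rangle$ with $\hat r<r^*<r$, then $\mathcal{G}(D,r)=D$. Otherwise, with $\hat r<r$ maximal such that $(\hat r,c)$ is empty, $\mathcal{G}(D,r)=(D\setminus\{(r,c)\})\cup\{(\hat r,c),\langle r,c\rangle\}$. $\mathrm{GKD}(D)$ is the set of all diagrams obtainable from $D$ by finite (possibly empty) sequences of ghost moves. The ghost Kohnert poset $\mathcal{P}_G(D)$ has underlying set $\mathrm{GKD}(D)$, with $D_2\preceq D_1$ iff $D_2$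 can be obtained from $D_1$ by a finite (possibly empty) sequence of ghost moves. The meet $x\wedge y$ is the greatest lower bound of $x$ and $y$. -}

module Defs where

open import Data.Nat using (ℕ; zero; suc; _≤_; _<_)
open import Data.Product using (Σ; _×_; ∃)
open import Data.Sum using (_⊎_)
open import Relation.Nullary using (¬_)
open import Relation.Binary.PropositionalEquality using (_≡_; _≢_)
open import Relation.Nullary.Decidable using (⌊_⌋)
open import Data.Bool using (if_then_else_)
open import Data.Nat using (_≟_)
open import Data.Bool using (_∧_)

data Cell : Set where
  empty ordinary ghost : Cell

-- Row r counted from the bottom, column c.  Positions with r = 0 or c = 0
-- are not positions of ℤ>0 × ℤ>0 and are required to be empty (see IsDiagram).
RawDiagram : Set
RawDiagram = ℕ → ℕ → Cell

IsDiagram : RawDiagram → Set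
IsDiagram D =
  (∀ c → D 0 c ≡ empty) ×
  (∀ r → D r 0 ≡ empty) ×
  (∃ λ N → ∀ r c → (N ≤ r ⊎ N ≤ c) → D r c ≡ empty)

_≈_ : RawDiagram → RawDiagram → Set
D ≈ E = ∀ r c → D r c ≡ E r c

NoGhosts : RawDiagram → Set
NoGhosts D = ∀ r c → D r c ≢ ghost

RowEmpty : RawDiagram → ℕ → Set
RowEmpty D r = ∀ c → D r c ≡ empty

Rightmost : RawDiagram → ℕ → ℕ → Set
Rightmost D r c = (D r c ≢ empty) × (∀ c′ → c < c′ → D r c′ ≡ empty)

MaxEmptyBelow : RawDiagram → ℕ → ℕ → ℕ → Set
MaxEmptyBelow D r c r̂ =
  (1 ≤ r̂) × (r̂ < r) × (D r̂ c ≡ empty) ×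
  (∀ k → r̂ < k → k < r → D k c ≢ empty)

NoOp : RawDiagram → ℕ → Set
NoOp D r =
  RowEmpty D r ⊎
  (Σ ℕ λ c → Rightmost D r c ×
     ( (D r c ≡ ghost)
     ⊎ (∀ r̂ → 1 ≤ r̂ → r̂ < r → D r̂ c ≢ empty)
     ⊎ (Σ ℕ λ r̂ → MaxEmptyBelow D r c r̂ ×
          (Σ ℕ λ r* → r̂ < r* × r* < r × D r* c ≡ ghost))))

moveCell : RawDiagram → ℕ → ℕ → ℕ → RawDiagram
moveCell D r c r̂ i j =
  if ⌊ i ≟ r ⌋ ∧ ⌊ j ≟ c ⌋ then ghost
  else if ⌊ i ≟ r̂ ⌋ ∧ ⌊ j ≟ c ⌋ then ordinary
  else D i j

-- GhostMove D r E  :  E = 𝒢(D , r)   (graph of the ghost move; it is a function)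
data GhostMove (D : RawDiagram) (r : ℕ) (E : RawDiagram) : Set where
  noop : NoOp D r → E ≈ D → GhostMove D r E
  move : (c r̂ : ℕ) → Rightmost D r c → D r c ≡ ordinary →
         MaxEmptyBelow D r c r̂ →
         (∀ r* → r̂ < r* → r* < r → D r* c ≢ ghost) →
         E ≈ moveCell D r c r̂ → GhostMove D r E

data Reach (D : RawDiagram) : RawDiagram → Set where
  done : ∀ {E} → D ≈ E → Reach D E
  step : ∀ {F E} (r : ℕ) → GhostMove D r F → Reach F E → Reach D E

_∈GKD_ : RawDiagram → RawDiagram → Set
E ∈GKD D = Reach D E

_⪯_ : RawDiagram → RawDiagram → Set
D₂ ⪯ D₁ = Reach D₁ D₂

_≺_ : RawDiagram → RawDiagram → Set
x ≺ y = x ⪯ y × ¬ (x ≈ y)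

Covers : RawDiagram → RawDiagram → RawDiagram → Set
Covers D x y = y ≺ x × ¬ (Σ RawDiagram λ z → z ∈GKD D × y ≺ z × z ≺ x)

IsMeet : RawDiagram → RawDiagram → RawDiagram → RawDiagram → Set
IsMeet D x y m =
  m ∈GKD D × m ⪯ x × m ⪯ y ×
  (∀ z → z ∈GKD D → z ⪯ x → z ⪯ y → z ⪯ m)

{-# OPTIONS --safe #-}
-- Each covering relation of the square is a single effective ghost move.  Comparing ghost sets
-- shows that D₁ → D₃ moves the same cell p = (b , c) that D₀ → D₂ moves.  If z lies below D₁
-- and D₂ then p is a ghost of z, so every path D₁ ↠ z moves p at some step, and that step can
-- be commuted to the front; being the move of row b from D₁, it is D₁ → D₃, hence z ⪯ D₃.
-- Commuting p's move past an earlier move of row r fails only if that move carries a cell of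
-- column c from above p to below it, or if p lands in row r right of the cell it moves.  The
-- first is excluded because a ghost at p freezes the number of ordinary cells above p in
-- column c.  For the second, wherever p is moved on the way from D₀ to z it lands in the row h
-- it lands in from D₀; as (h , c) is occupied in D₂, no cell left of it becomes a ghost in z.
module Submission where

open import Data.Bool using (true; false; _∧_)
open import Data.Empty using (⊥; ⊥-elim)
open import Data.Nat
open import Data.Nat.Properties
open import Data.Product
open import Data.Sum using (_⊎_; inj₁; inj₂)
open import Function using (_∘_)
open import Relation.Binary.Definitions using (DecidableEquality; tri<; tri≈; tri>)
open import Relation.Binary.PropositionalEquality
open import Relation.Nullary
open import Relation.Nullary.Decidable using (⌊_⌋; _×-dec_; decidable-stable)

open import Defs

_≟ᶜ_ : DecidableEquality Cell
empty    ≟ᶜ empty    = yes refl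
ordinary ≟ᶜ ordinary = yes refl
ghost    ≟ᶜ ghost    = yes refl
empty    ≟ᶜ ordinary = no λ ()
empty    ≟ᶜ ghost    = no λ ()
ordinary ≟ᶜ empty    = no λ ()
ordinary ≟ᶜ ghost    = no λ ()
ghost    ≟ᶜ empty    = no λ ()
ghost    ≟ᶜ ordinary = no λ ()

ordinary≢empty : ordinary ≢ empty
ordinary≢empty ()

ordinary≢ghost : ordinary ≢ ghost
ordinary≢ghost ()

ghost≢empty : ghost ≢ empty
ghost≢empty ()

≢empty∧≢ghost⇒ordinary : ∀ {x} → x ≢ empty → x ≢ ghost → x ≡ ordinary
≢empty∧≢ghost⇒ordinary {empty}    x≢empty _ = ⊥-elim (x≢empty refl)
≢empty∧≢ghost⇒ordinary {ordinary} _       _ = refl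
≢empty∧≢ghost⇒ordinary {ghost}    _ x≢ghost = ⊥-elim (x≢ghost refl)

≈-refl : ∀ {D} → D ≈ D
≈-refl _ _ = refl

≈-sym : ∀ {D E} → D ≈ E → E ≈ D
≈-sym D≈E r c = sym (D≈E r c)

≈-trans : ∀ {D E F} → D ≈ E → E ≈ F → D ≈ F
≈-trans D≈E E≈F r c = trans (D≈E r c) (E≈F r c)

≈-stable : ∀ {D E} → ¬ ¬ (D ≈ E) → D ≈ E
≈-stable {D} {E} ¬¬D≈E r c =
  decidable-stable (D r c ≟ᶜ E r c) λ D≢E → ¬¬D≈E λ D≈E → D≢E (D≈E r c)

position? : (i j r c : ℕ) → Dec (i ≡ r × j ≡ c)
position? i j r c = (i ≟ r) ×-dec (j ≟ c)

row≢⇒position≢ : ∀ {i j r c : ℕ} → i ≢ r → ¬ (i ≡ r × j ≡ c)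
row≢⇒position≢ i≢r (i≡r , _) = i≢r i≡r

column≢⇒position≢ : ∀ {i j r c : ℕ} → j ≢ c → ¬ (i ≡ r × j ≡ c)
column≢⇒position≢ j≢c (_ , j≡c) = j≢c j≡c

moveCell-source : ∀ D r c r̂ → moveCell D r c r̂ r c ≡ ghost
moveCell-source D r c r̂ with r ≟ r | c ≟ c
... | yes _   | yes _   = refl
... | no r≢r  | _       = ⊥-elim (r≢r refl)
... | yes _   | no c≢c  = ⊥-elim (c≢c refl)

moveCell-target : ∀ D r c r̂ → r̂ ≢ r → moveCell D r c r̂ r̂ c ≡ ordinary
moveCell-target D r c r̂ r̂≢r with r̂ ≟ r | c ≟ c | r̂ ≟ r̂
... | yes r̂≡r | _       | _        = ⊥-elim (r̂≢r r̂≡r)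
... | no _    | yes _   | yes _    = refl
... | no _    | no c≢c  | _        = ⊥-elim (c≢c refl)
... | no _    | yes _   | no r̂≢r̂  = ⊥-elim (r̂≢r̂ refl)

moveCell-elsewhere : ∀ D r c r̂ i j → ¬ (i ≡ r × j ≡ c) → ¬ (i ≡ r̂ × j ≡ c) →
  moveCell D r c r̂ i j ≡ D i j
moveCell-elsewhere D r c r̂ i j ≢source ≢target with i ≟ r | j ≟ c | i ≟ r̂
... | yes i≡r | yes j≡c | _       = ⊥-elim (≢source (i≡r , j≡c))
... | no _    | yes j≡c | yes i≡r̂ = ⊥-elim (≢target (i≡r̂ , j≡c))
... | yes _   | no _    | yes _   = refl
... | yes _   | no _    | no _    = refl
... | no _    | yes _   | no _    = refl
... | no _    | no _    | yes _   = refl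
... | no _    | no _    | no _    = refl

moveCell-cong : ∀ {D D′} r c r̂ → D ≈ D′ → moveCell D r c r̂ ≈ moveCell D′ r c r̂
moveCell-cong r c r̂ D≈D′ i j with ⌊ i ≟ r ⌋ ∧ ⌊ j ≟ c ⌋ | ⌊ i ≟ r̂ ⌋ ∧ ⌊ j ≟ c ⌋
... | true  | _     = refl
... | false | true  = refl
... | false | false = D≈D′ i j

module _ (D : RawDiagram) (r c r̂ r′ c′ r̂′ : ℕ) where
  private
    moved moved′ : RawDiagram
    moved  = moveCell D r c r̂
    moved′ = moveCell D r′ c′ r̂′

  moveCell-comm : r̂ ≢ r → r̂′ ≢ r′ →
    ¬ (r ≡ r′ × c ≡ c′) → ¬ (r ≡ r̂′ × c ≡ c′) → ¬ (r̂ ≡ r′ × c ≡ c′) → ¬ (r̂ ≡ r̂′ × c ≡ c′) →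
    moveCell moved′ r c r̂ ≈ moveCell moved r′ c′ r̂′
  moveCell-comm r̂≢r r̂′≢r′ d₀₀ d₀₁ d₁₀ d₁₁ i j
    with position? i j r c | position? i j r̂ c | position? i j r′ c′ | position? i j r̂′ c′
  ... | yes (refl , refl) | _ | _ | _ =
    trans (moveCell-source moved′ r c r̂)
          (sym (trans (moveCell-elsewhere moved r′ c′ r̂′ r c d₀₀ d₀₁) (moveCell-source D r c r̂)))
  ... | no _ | yes (refl , refl) | _ | _ =
    trans (moveCell-target moved′ r c r̂ r̂≢r)
          (sym (trans (moveCell-elsewhere moved r′ c′ r̂′ r̂ c d₁₀ d₁₁) (moveCell-target D r c r̂ r̂≢r)))
  ... | no n₁ | no n₂ | yes (refl , refl) | _ =
    trans (moveCell-elsewhere moved′ r c r̂ r′ c′ n₁ n₂)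
          (trans (moveCell-source D r′ c′ r̂′) (sym (moveCell-source moved r′ c′ r̂′)))
  ... | no n₁ | no n₂ | no _ | yes (refl , refl) =
    trans (moveCell-elsewhere moved′ r c r̂ r̂′ c′ n₁ n₂)
          (trans (moveCell-target D r′ c′ r̂′ r̂′≢r′) (sym (moveCell-target moved r′ c′ r̂′ r̂′≢r′)))
  ... | no n₁ | no n₂ | no n₃ | no n₄ =
    trans (moveCell-elsewhere moved′ r c r̂ i j n₁ n₂)
          (trans (moveCell-elsewhere D r′ c′ r̂′ i j n₃ n₄)
                 (sym (trans (moveCell-elsewhere moved r′ c′ r̂′ i j n₃ n₄) (moveCell-elsewhere D r c r̂ i j n₁ n₂))))

record Move (D : RawDiagram) (r c r̂ : ℕ) (E : RawDiagram) : Set where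
  field
    rightmost  : Rightmost D r c
    isOrdinary : D r c ≡ ordinary
    landing    : MaxEmptyBelow D r c r̂
    unblocked  : ∀ r* → r̂ < r* → r* < r → D r* c ≢ ghost
    result     : E ≈ moveCell D r c r̂

  1≤r̂ : 1 ≤ r̂
  1≤r̂ = proj₁ landing

  r̂<r : r̂ < r
  r̂<r = proj₁ (proj₂ landing)

  landing-empty : D r̂ c ≡ empty
  landing-empty = proj₁ (proj₂ (proj₂ landing))

  occupied-between : ∀ k → r̂ < k → k < r → D k c ≢ empty
  occupied-between = proj₂ (proj₂ (proj₂ landing))

  source-nonempty : D r c ≢ empty
  source-nonempty D≡empty = ordinary≢empty (trans (sym isOrdinary) D≡empty)

  source-ghost : E r c ≡ ghost
  source-ghost = trans (result r c) (moveCell-source D r c r̂)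

  landing-ordinary : E r̂ c ≡ ordinary
  landing-ordinary = trans (result r̂ c) (moveCell-target D r c r̂ (<⇒≢ r̂<r))

  elsewhere : ∀ {i j} → ¬ (i ≡ r × j ≡ c) → ¬ (i ≡ r̂ × j ≡ c) → E i j ≡ D i j
  elsewhere {i} {j} ≢source ≢target = trans (result i j) (moveCell-elsewhere D r c r̂ i j ≢source ≢target)

  ghost-preserved : ∀ {i j} → D i j ≡ ghost → E i j ≡ ghost
  ghost-preserved {i} {j} g with position? i j r c | position? i j r̂ c
  ... | yes (refl , refl) | _                 = source-ghost
  ... | no _              | yes (refl , refl) = ⊥-elim (ghost≢empty (trans (sym g) landing-empty))
  ... | no ≢source        | no ≢target        = trans (elsewhere ≢source ≢target) g

  nonempty-preserved : ∀ {i j} → D i j ≢ empty → E i j ≢ empty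
  nonempty-preserved {i} {j} occupied with position? i j r c | position? i j r̂ c
  ... | yes (refl , refl) | _                 = ghost≢empty ∘ trans (sym source-ghost)
  ... | no _              | yes (refl , refl) = ordinary≢empty ∘ trans (sym landing-ordinary)
  ... | no ≢source        | no ≢target        = occupied ∘ trans (sym (elsewhere ≢source ≢target))

  ordinary-preserved : ∀ {i j} → D i j ≡ ordinary → i ≢ r → E i j ≡ ordinary
  ordinary-preserved {i} {j} o i≢r with position? i j r̂ c
  ... | yes (refl , refl) = landing-ordinary
  ... | no ≢target        = trans (elsewhere (row≢⇒position≢ i≢r) ≢target) o

  ghost-origin : ∀ {i j} → E i j ≡ ghost → (i ≡ r × j ≡ c) ⊎ D i j ≡ ghost
  ghost-origin {i} {j} g with position? i j r c | position? i j r̂ c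
  ... | yes is-source | _                 = inj₁ is-source
  ... | no _          | yes (refl , refl) = ⊥-elim (ordinary≢ghost (trans (sym landing-ordinary) g))
  ... | no ≢source    | no ≢target        = inj₂ (trans (sym (elsewhere ≢source ≢target)) g)

  empty-reflected : ∀ {i j} → E i j ≡ empty → D i j ≡ empty
  empty-reflected {i} {j} E≡empty with D i j ≟ᶜ empty
  ... | yes D≡empty = D≡empty
  ... | no D≢empty  = ⊥-elim (nonempty-preserved D≢empty E≡empty)

  nontrivial : ¬ (E ≈ D)
  nontrivial E≈D = ordinary≢ghost (trans (sym isOrdinary) (trans (sym (E≈D r c)) source-ghost))

open Move

Move-respˡ : ∀ {D D′ r c r̂ E} → D ≈ D′ → Move D r c r̂ E → Move D′ r c r̂ E
Move-respˡ {r = r} {c} {r̂} D≈D′ m = record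
  { rightmost  = source-nonempty m ∘ trans (D≈D′ r c)
               , λ c′ c<c′ → trans (sym (D≈D′ r c′)) (proj₂ (rightmost m) c′ c<c′)
  ; isOrdinary = trans (sym (D≈D′ r c)) (isOrdinary m)
  ; landing    = 1≤r̂ m , r̂<r m , trans (sym (D≈D′ r̂ c)) (landing-empty m)
               , λ k r̂<k k<r → occupied-between m k r̂<k k<r ∘ trans (D≈D′ k c)
  ; unblocked  = λ k r̂<k k<r → unblocked m k r̂<k k<r ∘ trans (D≈D′ k c)
  ; result     = ≈-trans (result m) (moveCell-cong r c r̂ D≈D′)
  }

Move-respʳ : ∀ {D r c r̂ E E′} → E ≈ E′ → Move D r c r̂ E → Move D r c r̂ E′
Move-respʳ E≈E′ m = record
  { rightmost = rightmost m ; isOrdinary = isOrdinary m ; landing = landing m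
  ; unblocked = unblocked m ; result = ≈-trans (≈-sym E≈E′) (result m) }

Rightmost-unique : ∀ {D r c c′} → Rightmost D r c → Rightmost D r c′ → c ≡ c′
Rightmost-unique {c = c} {c′} (occupied , empty-after) (occupied′ , empty-after′) with <-cmp c c′
... | tri< c<c′ _ _ = ⊥-elim (occupied′ (empty-after c′ c<c′))
... | tri≈ _ c≡c′ _ = c≡c′
... | tri> _ _ c′<c = ⊥-elim (occupied (empty-after′ c c′<c))

MaxEmptyBelow-unique : ∀ {D r c r̂ r̂′} → MaxEmptyBelow D r c r̂ → MaxEmptyBelow D r c r̂′ → r̂ ≡ r̂′
MaxEmptyBelow-unique {r̂ = r̂} {r̂′} (_ , r̂<r , empty₁ , occupied₁) (_ , r̂′<r , empty₂ , occupied₂)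
  with <-cmp r̂ r̂′
... | tri< r̂<r̂′ _ _ = ⊥-elim (occupied₁ r̂′ r̂<r̂′ r̂′<r empty₂)
... | tri≈ _ r̂≡r̂′ _ = r̂≡r̂′
... | tri> _ _ r̂′<r̂ = ⊥-elim (occupied₂ r̂ r̂′<r̂ r̂<r empty₁)

Move-deterministic : ∀ {D r c r̂ E c′ r̂′ E′} → Move D r c r̂ E → Move D r c′ r̂′ E′ → E ≈ E′
Move-deterministic {D} {r} m m′ with Rightmost-unique {D} {r} (rightmost m) (rightmost m′)
... | refl with MaxEmptyBelow-unique {D} {r} (landing m) (landing m′)
...   | refl = ≈-trans (result m) (≈-sym (result m′))

Move⇒GhostMove : ∀ {D r c r̂ E} → Move D r c r̂ E → GhostMove D r E
Move⇒GhostMove {c = c} {r̂} m = move c r̂ (rightmost m) (isOrdinary m) (landing m) (unblocked m) (result m)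

ghostMove-cases : ∀ {D r E} → GhostMove D r E → E ≈ D ⊎ Σ ℕ λ c → Σ ℕ λ r̂ → Move D r c r̂ E
ghostMove-cases (noop _ E≈D)                     = inj₁ E≈D
ghostMove-cases (move c r̂ rm o land free E≈move) = inj₂ (c , r̂ , record
  { rightmost = rm ; isOrdinary = o ; landing = land ; unblocked = free ; result = E≈move })

Move⇒Reach : ∀ {D r c r̂ E} → Move D r c r̂ E → Reach D E
Move⇒Reach {r = r} m = step r (Move⇒GhostMove m) (done ≈-refl)

Reach-respˡ : ∀ {D D′ E} → D ≈ D′ → Reach D E → Reach D′ E
Reach-respˡ D≈D′ (done D≈E) = done (≈-trans (≈-sym D≈D′) D≈E)
Reach-respˡ D≈D′ (step r g F↠E) with ghostMove-cases g
... | inj₁ F≈D         = Reach-respˡ (≈-trans F≈D D≈D′) F↠E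
... | inj₂ (_ , _ , m) = step r (Move⇒GhostMove (Move-respˡ D≈D′ m)) F↠E

Reach-respʳ : ∀ {D E E′} → E ≈ E′ → Reach D E → Reach D E′
Reach-respʳ E≈E′ (done D≈E)     = done (≈-trans D≈E E≈E′)
Reach-respʳ E≈E′ (step r g F↠E) = step r g (Reach-respʳ E≈E′ F↠E)

Reach-trans : ∀ {D E F} → Reach D E → Reach E F → Reach D F
Reach-trans (done D≈E)     E↠F = Reach-respˡ (≈-sym D≈E) E↠F
Reach-trans (step r g G↠E) E↠F = step r g (Reach-trans G↠E E↠F)

Reach-first-move : ∀ {D E} → Reach D E → ¬ (E ≈ D) →
  Σ ℕ λ r → Σ ℕ λ c → Σ ℕ λ r̂ → Σ RawDiagram λ F → Move D r c r̂ F × Reach F E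
Reach-first-move (done D≈E) E≉D = ⊥-elim (E≉D (≈-sym D≈E))
Reach-first-move (step r g F↠E) E≉D with ghostMove-cases g
... | inj₂ (c , r̂ , m) = r , c , r̂ , _ , m , F↠E
... | inj₁ F≈D with Reach-first-move F↠E (E≉D ∘ λ E≈F → ≈-trans E≈F F≈D)
...   | r′ , c , r̂ , G , m , G↠E = r′ , c , r̂ , G , Move-respˡ F≈D m , G↠E

covers⇒Move : ∀ {D x y} → x ∈GKD D → Covers D x y → Σ ℕ λ r → Σ ℕ λ c → Σ ℕ λ r̂ → Move x r c r̂ y
covers⇒Move x∈ ((y⪯x , y≉x) , nothing-between) with Reach-first-move y⪯x y≉x
... | r , c , r̂ , F , m , F↠y = r , c , r̂ , Move-respʳ F≈y m
  where
  F≈y : _ ≈ _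
  F≈y = ≈-stable λ F≉y → nothing-between
    (F , Reach-trans x∈ (Move⇒Reach m) , (F↠y , F≉y ∘ ≈-sym) , (Move⇒Reach m , nontrivial m))

record Invariant (P : RawDiagram → Set) : Set where
  field
    respects-≈ : ∀ {D E} → D ≈ E → P D → P E
    preserved  : ∀ {D r c r̂ E} → Move D r c r̂ E → P D → P E

Reach-invariant : ∀ {P D E} → Invariant P → Reach D E → P D → P E
Reach-invariant inv (done D≈E) = Invariant.respects-≈ inv D≈E
Reach-invariant inv (step r g F↠E) p with ghostMove-cases g
... | inj₁ F≈D         = Reach-invariant inv F↠E (Invariant.respects-≈ inv (≈-sym F≈D) p)
... | inj₂ (_ , _ , m) = Reach-invariant inv F↠E (Invariant.preserved inv m p)

ghost-persists : ∀ {D E i j} → Reach D E → D i j ≡ ghost → E i j ≡ ghost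
ghost-persists {i = i} {j} = Reach-invariant record
  { respects-≈ = λ D≈E → trans (sym (D≈E i j))
  ; preserved  = λ m → ghost-preserved m }

nonempty-persists : ∀ {D E i j} → Reach D E → D i j ≢ empty → E i j ≢ empty
nonempty-persists {i = i} {j} = Reach-invariant record
  { respects-≈ = λ D≈E occupied → occupied ∘ trans (D≈E i j)
  ; preserved  = λ m → nonempty-preserved m }

left-of-occupied-stays-non-ghost : ∀ {D E r c c′} → Reach D E → c < c′ →
  D r c′ ≢ empty → D r c ≢ ghost → E r c ≢ ghost
left-of-occupied-stays-non-ghost {r = r} {c} {c′} D↠E c<c′ occupied ¬ghost =
  proj₂ (Reach-invariant inv D↠E (occupied , ¬ghost))
  where
  inv : Invariant λ X → X r c′ ≢ empty × X r c ≢ ghost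
  inv = record
    { respects-≈ = λ X≈Y (occ , ¬g) → occ ∘ trans (X≈Y r c′) , ¬g ∘ trans (X≈Y r c)
    ; preserved  = λ m (occ , ¬g) → nonempty-preserved m occ , λ g → case-origin m occ ¬g (ghost-origin m g) }
    where
    case-origin : ∀ {X r₀ c₀ r̂ Y} → Move X r₀ c₀ r̂ Y → X r c′ ≢ empty → X r c ≢ ghost →
      (r ≡ r₀ × c ≡ c₀) ⊎ X r c ≡ ghost → ⊥
    case-origin m occ _  (inj₁ (refl , refl)) = occ (proj₂ (rightmost m) c′ c<c′)
    case-origin m _   ¬g (inj₂ g)             = ¬g g

Bounded : ℕ → RawDiagram → Set
Bounded M D = ∀ r c → M ≤ r → D r c ≡ empty

Bounded-respects-≈ : ∀ {M D E} → D ≈ E → Bounded M D → Bounded M E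
Bounded-respects-≈ D≈E bounded i j M≤i = trans (sym (D≈E i j)) (bounded i j M≤i)

module _ {D r c r̂ E} (m : Move D r c r̂ E) where

  source<bound : ∀ {M} → Bounded M D → r < M
  source<bound {M} bounded with M ≤? r
  ... | yes M≤r = ⊥-elim (source-nonempty m (bounded r c M≤r))
  ... | no M≰r  = ≰⇒> M≰r

  Bounded-preserved : ∀ {M} → Bounded M D → Bounded M E
  Bounded-preserved bounded i j M≤i =
    trans (elsewhere m (row≢⇒position≢ (>⇒≢ r<i)) (row≢⇒position≢ (>⇒≢ (<-trans (r̂<r m) r<i))))
          (bounded i j M≤i)
    where
    r<i = <-≤-trans (source<bound bounded) M≤i

Bounded-persists : ∀ {M D E} → Reach D E → Bounded M D → Bounded M E
Bounded-persists = Reach-invariant record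
  { respects-≈ = Bounded-respects-≈ ; preserved = λ m → Bounded-preserved m }

ordinaryIndicator : Cell → ℕ
ordinaryIndicator ordinary = 1
ordinaryIndicator empty    = 0
ordinaryIndicator ghost    = 0

ordinaryIndicator≤1 : ∀ x → ordinaryIndicator x ≤ 1
ordinaryIndicator≤1 ordinary = ≤-refl
ordinaryIndicator≤1 empty    = z≤n
ordinaryIndicator≤1 ghost    = z≤n

ordinaryCount : RawDiagram → (c lo k : ℕ) → ℕ
ordinaryCount D c lo zero    = 0
ordinaryCount D c lo (suc k) = ordinaryIndicator (D lo c) + ordinaryCount D c (suc lo) k

ordinaryCount-cong : ∀ {D E c lo} k → (∀ i → lo ≤ i → D i c ≡ E i c) →
  ordinaryCount D c lo k ≡ ordinaryCount E c lo k
ordinaryCount-cong zero    _     = refl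
ordinaryCount-cong {lo = lo} (suc k) D≡E =
  cong₂ _+_ (cong ordinaryIndicator (D≡E lo ≤-refl)) (ordinaryCount-cong k λ i lo<i → D≡E i (<⇒≤ lo<i))

ordinaryCount-respects-≈ : ∀ {D E} c lo k → D ≈ E → ordinaryCount D c lo k ≡ ordinaryCount E c lo k
ordinaryCount-respects-≈ c lo k D≈E = ordinaryCount-cong k λ i _ → D≈E i c

ordinaryCount-≤ : ∀ D c lo k → ordinaryCount D c lo k ≤ k
ordinaryCount-≤ D c lo zero    = z≤n
ordinaryCount-≤ D c lo (suc k) = +-mono-≤ (ordinaryIndicator≤1 (D lo c)) (ordinaryCount-≤ D c (suc lo) k)

ordinaryCount-full : ∀ {D c} lo k → (∀ i → lo ≤ i → i < lo + k → D i c ≡ ordinary) →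
  ordinaryCount D c lo k ≡ k
ordinaryCount-full lo zero    _       = refl
ordinaryCount-full lo (suc k) all-ord rewrite all-ord lo ≤-refl (m<m+n lo z<s) =
  cong suc (ordinaryCount-full (suc lo) k λ i lo<i i<end →
    all-ord i (<⇒≤ lo<i) (subst (i <_) (sym (+-suc lo k)) i<end))

ordinaryCount-+ : ∀ D c lo k l → ordinaryCount D c lo (k + l) ≡ ordinaryCount D c lo k + ordinaryCount D c (lo + k) l
ordinaryCount-+ D c lo zero    l rewrite +-identityʳ lo = refl
ordinaryCount-+ D c lo (suc k) l rewrite +-suc lo k =
  trans (cong (ordinaryIndicator (D lo c) +_) (ordinaryCount-+ D c (suc lo) k l))
        (sym (+-assoc (ordinaryIndicator (D lo c)) _ _))

module _ {D r c r̂ E} (m : Move D r c r̂ E) where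

  count-other-column : ∀ c′ lo k → c′ ≢ c → ordinaryCount E c′ lo k ≡ ordinaryCount D c′ lo k
  count-other-column c′ lo k c′≢c =
    ordinaryCount-cong k λ i _ → elsewhere m (column≢⇒position≢ c′≢c) (column≢⇒position≢ c′≢c)

  count-above-source : ∀ lo k → r < lo → ordinaryCount E c lo k ≡ ordinaryCount D c lo k
  count-above-source lo k r<lo = ordinaryCount-cong k λ i lo≤i →
    elsewhere m (row≢⇒position≢ (>⇒≢ (<-≤-trans r<lo lo≤i)))
                (row≢⇒position≢ (>⇒≢ (<-≤-trans (<-trans (r̂<r m) r<lo) lo≤i)))

  count-across : ∀ lo k → r̂ < lo → lo ≤ r → r < lo + k →
    suc (ordinaryCount E c lo k) ≡ ordinaryCount D c lo k
  count-across lo zero r̂<lo lo≤r r<lo+0 = ⊥-elim (<⇒≱ (subst (r <_) (+-identityʳ lo) r<lo+0) lo≤r)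
  count-across lo (suc k) r̂<lo lo≤r r<end with lo ≟ r
  ... | yes refl rewrite source-ghost m | isOrdinary m = cong suc (count-above-source (suc r) k ≤-refl)
  ... | no lo≢r rewrite elsewhere m {lo} {c} (row≢⇒position≢ lo≢r) (row≢⇒position≢ (>⇒≢ r̂<lo)) =
    trans (sym (+-suc _ _))
          (cong (ordinaryIndicator (D lo c) +_)
                (count-across (suc lo) k (m<n⇒m<1+n r̂<lo) (≤∧≢⇒< lo≤r lo≢r) (subst (r <_) (+-suc lo k) r<end)))

  count-around : ∀ lo k → lo ≤ r̂ → r < lo + k → ordinaryCount E c lo k ≡ ordinaryCount D c lo k
  count-around lo zero lo≤r̂ r<lo+0 =
    ⊥-elim (<⇒≱ (<-trans (r̂<r m) (subst (r <_) (+-identityʳ lo) r<lo+0)) lo≤r̂)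
  count-around lo (suc k) lo≤r̂ r<end with lo ≟ r̂
  ... | yes refl rewrite landing-ordinary m | landing-empty m =
    count-across (suc lo) k ≤-refl (r̂<r m) (subst (r <_) (+-suc lo k) r<end)
  ... | no lo≢r̂ rewrite elsewhere m {lo} {c} (row≢⇒position≢ (<⇒≢ (≤-<-trans lo≤r̂ (r̂<r m)))) (row≢⇒position≢ lo≢r̂) =
    cong (ordinaryIndicator (D lo c) +_) (count-around (suc lo) k (≤∧≢⇒< lo≤r̂ lo≢r̂) (subst (r <_) (+-suc lo k) r<end))

  private
    source<end : ∀ {M lo k} → Bounded M D → M ≤ k → r < lo + k
    source<end {lo = lo} {k} bounded M≤k = <-≤-trans (source<bound m bounded) (≤-trans M≤k (m≤n+m k lo))

  count-move-≤ : ∀ {M} c′ lo k → Bounded M D → M ≤ k → ordinaryCount E c′ lo k ≤ ordinaryCount D c′ lo k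
  count-move-≤ c′ lo k bounded M≤k with c′ ≟ c
  ... | no c′≢c = ≤-reflexive (count-other-column c′ lo k c′≢c)
  ... | yes refl with lo ≤? r̂ | lo ≤? r
  ...   | yes lo≤r̂ | _        = ≤-reflexive (count-around lo k lo≤r̂ (source<end bounded M≤k))
  ...   | no lo≰r̂  | yes lo≤r = <⇒≤ (≤-reflexive (count-across lo k (≰⇒> lo≰r̂) lo≤r (source<end bounded M≤k)))
  ...   | no _     | no lo≰r  = ≤-reflexive (count-above-source lo k (≰⇒> lo≰r))

  count-above-ghost : ∀ {M} c′ b k → Bounded M D → M ≤ k → D b c′ ≡ ghost →
    ordinaryCount E c′ (suc b) k ≡ ordinaryCount D c′ (suc b) k
  count-above-ghost c′ b k bounded M≤k g with c′ ≟ c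
  ... | no c′≢c = count-other-column c′ (suc b) k c′≢c
  ... | yes refl with suc b ≤? r̂ | suc b ≤? r
  ...   | yes b<r̂ | _       = count-around (suc b) k b<r̂ (source<end bounded M≤k)
  ...   | no _    | no b≮r  = count-above-source (suc b) k (≰⇒> b≮r)
  ...   | no b≮r̂  | yes b<r = ⊥-elim (unblocked m b r̂<b b<r g)
    where
    r̂<b : r̂ < b
    r̂<b = ≤∧≢⇒< (≤-pred (≰⇒> b≮r̂)) λ { refl → ghost≢empty (trans (sym g) (landing-empty m)) }

count-Reach-≤ : ∀ {M D E} c lo k → Reach D E → Bounded M D → M ≤ k →
  ordinaryCount E c lo k ≤ ordinaryCount D c lo k
count-Reach-≤ {M} {D} c lo k D↠E bounded M≤k = proj₂ (Reach-invariant inv D↠E (bounded , ≤-refl))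
  where
  inv : Invariant λ X → Bounded M X × ordinaryCount X c lo k ≤ ordinaryCount D c lo k
  inv = record
    { respects-≈ = λ X≈Y (bX , X≤D) →
        Bounded-respects-≈ X≈Y bX , ≤-trans (≤-reflexive (ordinaryCount-respects-≈ c lo k (≈-sym X≈Y))) X≤D
    ; preserved  = λ m (bX , X≤D) → Bounded-preserved m bX , ≤-trans (count-move-≤ m c lo k bX M≤k) X≤D }

-- No cell can pass a ghost on its way down.
count-above-ghost-persists : ∀ {M D E b} c k → Reach D E → Bounded M D → M ≤ k → D b c ≡ ghost →
  ordinaryCount E c (suc b) k ≡ ordinaryCount D c (suc b) k
count-above-ghost-persists {M} {D} {b = b} c k D↠E bounded M≤k g =
  proj₂ (proj₂ (Reach-invariant inv D↠E (bounded , g , refl)))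
  where
  inv : Invariant λ X → Bounded M X × X b c ≡ ghost × ordinaryCount X c (suc b) k ≡ ordinaryCount D c (suc b) k
  inv = record
    { respects-≈ = λ X≈Y (bX , gX , X≡D) →
        Bounded-respects-≈ X≈Y bX , trans (sym (X≈Y b c)) gX
        , trans (ordinaryCount-respects-≈ c (suc b) k (≈-sym X≈Y)) X≡D
    ; preserved  = λ m (bX , gX , X≡D) →
        Bounded-preserved m bX , ghost-preserved m gX , trans (count-above-ghost m c b k bX M≤k gX) X≡D }

module _ {S r c x̂ F b cb h′ Fb} (m : Move S r c x̂ F) (m′ : Move F b cb h′ Fb) where

  Move-hoist : r ≢ b → S b cb ≡ ordinary → ¬ (c ≡ cb × x̂ < b × b < r) →
    Move S b cb h′ (moveCell S b cb h′)
  Move-hoist r≢b S-ordinary ¬jump = record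
    { rightmost  = ordinary≢empty ∘ trans (sym S-ordinary)
                 , λ c′ cb<c′ → empty-reflected m (proj₂ (rightmost m′) c′ cb<c′)
    ; isOrdinary = S-ordinary
    ; landing    = 1≤r̂ m′ , r̂<r m′ , empty-reflected m (landing-empty m′) , occupied-in-S
    ; unblocked  = λ k h′<k k<b → unblocked m′ k h′<k k<b ∘ ghost-preserved m
    ; result     = ≈-refl }
    where
    occupied-in-S : ∀ k → h′ < k → k < b → S k cb ≢ empty
    occupied-in-S k h′<k k<b with position? k cb r c | position? k cb x̂ c
    ... | yes (refl , refl) | _ = source-nonempty m
    ... | no _ | yes (refl , refl) with <-cmp b r
    ...   | tri< b<r _ _ = ⊥-elim (¬jump (refl , k<b , b<r))
    ...   | tri≈ _ b≡r _ = ⊥-elim (r≢b (sym b≡r))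
    ...   | tri> _ _ r<b = ⊥-elim (unblocked m′ r (<-trans h′<k (r̂<r m)) r<b (source-ghost m))
    occupied-in-S k h′<k k<b | no ≢source | no ≢target =
      occupied-between m′ k h′<k k<b ∘ trans (elsewhere m ≢source ≢target)

  private
    source≢landing′ : ¬ (r ≡ h′ × c ≡ cb)
    source≢landing′ (refl , refl) = ghost≢empty (trans (sym (source-ghost m)) (landing-empty m′))

    landing≢landing′ : ¬ (x̂ ≡ h′ × c ≡ cb)
    landing≢landing′ (refl , refl) = ordinary≢empty (trans (sym (landing-ordinary m)) (landing-empty m′))

    landing≢source′ : S b cb ≡ ordinary → ¬ (x̂ ≡ b × c ≡ cb)
    landing≢source′ S-ordinary (refl , refl) = ordinary≢empty (trans (sym S-ordinary) (landing-empty m))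

  Move-delay : ∀ {S′} → r ≢ b → Move S b cb h′ S′ → ¬ (c < cb × r ≡ h′) → ¬ (c ≡ cb × x̂ < b × b < r) →
    Move S′ r c x̂ (moveCell S′ r c x̂)
  Move-delay {S′} r≢b hoisted ¬beside ¬jump = record
    { rightmost  = ordinary≢empty ∘ trans (sym S′-ordinary) , empty-right
    ; isOrdinary = S′-ordinary
    ; landing    = 1≤r̂ m , r̂<r m
                 , trans (elsewhere hoisted (landing≢source′ (isOrdinary hoisted)) landing≢landing′) (landing-empty m)
                 , λ k x̂<k k<r → nonempty-preserved hoisted (occupied-between m k x̂<k k<r)
    ; unblocked  = unblocked-in-S′
    ; result     = ≈-refl }
    where
    S′-ordinary : S′ r c ≡ ordinary
    S′-ordinary = trans (elsewhere hoisted (row≢⇒position≢ r≢b) source≢landing′) (isOrdinary m)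

    empty-right : ∀ c′ → c < c′ → S′ r c′ ≡ empty
    empty-right c′ c<c′ with position? r c′ b cb | position? r c′ h′ cb
    ... | yes (r≡b , _) | _ = ⊥-elim (r≢b r≡b)
    ... | no _ | yes (r≡h′ , refl) = ⊥-elim (¬beside (c<c′ , r≡h′))
    ... | no ≢source | no ≢target = trans (elsewhere hoisted ≢source ≢target) (proj₂ (rightmost m) c′ c<c′)

    unblocked-in-S′ : ∀ k → x̂ < k → k < r → S′ k c ≢ ghost
    unblocked-in-S′ k x̂<k k<r g with ghost-origin hoisted g
    ... | inj₁ (refl , refl) = ¬jump (refl , x̂<k , k<r)
    ... | inj₂ g′            = unblocked m k x̂<k k<r g′

  swap-moves : r ≢ b → S b cb ≡ ordinary → ¬ (c < cb × r ≡ h′) → ¬ (c ≡ cb × x̂ < b × b < r) →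
    Move S b cb h′ (moveCell S b cb h′) × Reach (moveCell S b cb h′) Fb
  swap-moves r≢b S-ordinary ¬beside ¬jump =
    hoisted , Reach-respʳ commuted (Move⇒Reach (Move-delay r≢b hoisted ¬beside ¬jump))
    where
    hoisted = Move-hoist r≢b S-ordinary ¬jump

    commuted : moveCell (moveCell S b cb h′) r c x̂ ≈ Fb
    commuted = ≈-trans
      (moveCell-comm S r c x̂ b cb h′ (<⇒≢ (r̂<r m)) (<⇒≢ (r̂<r m′))
         (row≢⇒position≢ r≢b) source≢landing′ (landing≢source′ S-ordinary) landing≢landing′)
      (≈-trans (≈-sym (moveCell-cong b cb h′ (result m))) (≈-sym (result m′)))

module _ {M E b cb h Eb z} (mE : Move E b cb h Eb) (bounded : Bounded M E) (Eb↠z : Reach Eb z) where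

  private
    above : RawDiagram → ℕ
    above X = ordinaryCount X cb (suc b) M

    z-ghost : z b cb ≡ ghost
    z-ghost = ghost-persists Eb↠z (source-ghost mE)

    above-E≤ : ∀ {X} → Reach E X → Reach X z → above E ≤ above X
    above-E≤ {X} E↠X X↠z = begin
      above E  ≡⟨ count-above-source mE (suc b) M ≤-refl ⟨
      above Eb ≡⟨ count-above-ghost-persists cb M Eb↠z (Bounded-preserved mE bounded) ≤-refl (source-ghost mE) ⟨
      above z  ≤⟨ count-Reach-≤ cb (suc b) M X↠z (Bounded-persists E↠X bounded) ≤-refl ⟩
      above X  ∎
      where open ≤-Reasoning

    landing-unchanged : ∀ {F h′ F′} → Reach E F → Reach F z → Move F b cb h′ F′ → h′ ≡ h
    landing-unchanged {F} {h′} E↠F F↠z m with <-cmp h′ h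
    ... | tri≈ _ h′≡h _ = h′≡h
    ... | tri> _ _ h<h′ = ⊥-elim (nonempty-persists E↠F (occupied-between mE h′ h<h′ (r̂<r m)) (landing-empty m))
    ... | tri< h′<h _ _ = ⊥-elim (<-irrefl refl more-in-F)
      where
      d = b ∸ h
      h+1+d≡1+b : h + suc d ≡ suc b
      h+1+d≡1+b = trans (+-suc h d) (cong suc (m+[n∸m]≡n (<⇒≤ (r̂<r mE))))

      split : ∀ X → ordinaryCount X cb h (suc d + M) ≡ ordinaryCount X cb h (suc d) + above X
      split X = trans (ordinaryCount-+ X cb h (suc d) M) (cong (λ t → ordinaryCount X cb h (suc d) + ordinaryCount X cb t M) h+1+d≡1+b)

      full-in-F : ordinaryCount F cb h (suc d) ≡ suc d
      full-in-F = ordinaryCount-full h (suc d) λ i h≤i i<end → ordinary-in-F i (<-≤-trans h′<h h≤i)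
        (≤-pred (subst (i <_) h+1+d≡1+b i<end))
        where
        ordinary-in-F : ∀ i → h′ < i → i ≤ b → F i cb ≡ ordinary
        ordinary-in-F i h′<i i≤b with i ≟ b
        ... | yes refl = isOrdinary m
        ... | no i≢b   = ≢empty∧≢ghost⇒ordinary (occupied-between m i h′<i (≤∧≢⇒< i≤b i≢b))
                                                (unblocked m i h′<i (≤∧≢⇒< i≤b i≢b))

      hole-in-E : ordinaryCount E cb h (suc d) ≤ d
      hole-in-E rewrite landing-empty mE = ordinaryCount-≤ E cb (suc h) d

      more-in-F : suc d + above E ≤ d + above E
      more-in-F = begin
        suc d + above E                    ≤⟨ +-monoʳ-≤ (suc d) (above-E≤ E↠F F↠z) ⟩
        suc d + above F                    ≡⟨ trans (split F) (cong (_+ above F) full-in-F) ⟨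
        ordinaryCount F cb h (suc d + M)   ≤⟨ count-Reach-≤ cb h (suc d + M) E↠F bounded (m≤n+m M (suc d)) ⟩
        ordinaryCount E cb h (suc d + M)   ≡⟨ split E ⟩
        ordinaryCount E cb h (suc d) + above E ≤⟨ +-monoˡ-≤ (above E) hole-in-E ⟩
        d + above E                        ∎
        where open ≤-Reasoning

    ¬jump-over : ∀ {S r c x̂ F} → Reach E S → Move S r c x̂ F → Reach F z → ¬ (c ≡ cb × x̂ < b × b < r)
    ¬jump-over {S} E↠S m F↠z (refl , x̂<b , b<r) = <-irrefl refl (begin-strict
      above E  ≤⟨ above-E≤ (Reach-trans E↠S (Move⇒Reach m)) F↠z ⟩
      above _  <⟨ ≤-reflexive (count-across m (suc b) M (m<n⇒m<1+n x̂<b) b<r r<end) ⟩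
      above S  ≤⟨ count-Reach-≤ cb (suc b) M E↠S bounded ≤-refl ⟩
      above E  ∎)
      where
      open ≤-Reasoning
      r<end = <-≤-trans (source<bound m (Bounded-persists E↠S bounded)) (m≤n+m M (suc b))

    ¬land-beside : ∀ {S r c x̂ F h′ Fb} → Reach E S → Move S r c x̂ F → Reach F z →
      Move F b cb h′ Fb → ¬ (c < cb × r ≡ h′)
    ¬land-beside {S} {r} {c} E↠S m F↠z m′ (c<cb , r≡h′) =
      left-of-occupied-stays-non-ghost Eb↠z c<cb Eb-occupied Eb-not-ghost (ghost-persists F↠z (source-ghost m))
      where
      r≡h : r ≡ h
      r≡h = trans r≡h′ (landing-unchanged (Reach-trans E↠S (Move⇒Reach m)) F↠z m′)

      Eb-occupied : Eb r cb ≢ empty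
      Eb-occupied rewrite r≡h = ordinary≢empty ∘ trans (sym (landing-ordinary mE))

      Eb-not-ghost : Eb r c ≢ ghost
      Eb-not-ghost g = ordinary≢ghost (trans (sym (isOrdinary m)) (ghost-persists E↠S E-ghost))
        where
        c≢cb = <⇒≢ c<cb
        E-ghost = trans (sym (elsewhere mE (column≢⇒position≢ c≢cb) (column≢⇒position≢ c≢cb))) g

    rightmost-is-ghosted : ∀ {S c x̂ F} → Reach S z → Move S b c x̂ F → S b cb ≡ ordinary → c ≡ cb
    rightmost-is-ghosted {c = c} S↠z m S-ordinary with <-cmp c cb
    ... | tri≈ _ c≡cb _ = c≡cb
    ... | tri< c<cb _ _ = ⊥-elim (ordinary≢empty (trans (sym S-ordinary) (proj₂ (rightmost m) cb c<cb)))
    ... | tri> _ _ cb<c = ⊥-elim (left-of-occupied-stays-non-ghost S↠z cb<c (source-nonempty m)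
                                    (ordinary≢ghost ∘ trans (sym S-ordinary)) z-ghost)

  ghosting-move-first : ∀ {S} → Reach E S → Reach S z → S b cb ≡ ordinary →
    Σ ℕ λ h′ → Σ RawDiagram λ S′ → Move S b cb h′ S′ × Reach S′ z
  ghosting-move-first E↠S (done S≈z) S-ordinary =
    ⊥-elim (ordinary≢ghost (trans (sym S-ordinary) (trans (S≈z b cb) z-ghost)))
  ghosting-move-first E↠S (step r g F↠z) S-ordinary with ghostMove-cases g
  ... | inj₁ F≈S with ghosting-move-first (Reach-respʳ (≈-sym F≈S) E↠S) F↠z (trans (F≈S b cb) S-ordinary)
  ...   | h′ , S′ , m′ , S′↠z = h′ , S′ , Move-respˡ F≈S m′ , S′↠z
  ghosting-move-first E↠S (step r g F↠z) S-ordinary | inj₂ (c , x̂ , m) with r ≟ b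
  ... | yes refl with rightmost-is-ghosted (Reach-trans (Move⇒Reach m) F↠z) m S-ordinary
  ...   | refl = x̂ , _ , m , F↠z
  ghosting-move-first E↠S (step r g F↠z) S-ordinary | inj₂ (c , x̂ , m) | no r≢b
    with ghosting-move-first (Reach-trans E↠S (Move⇒Reach m)) F↠z (ordinary-preserved m S-ordinary (r≢b ∘ sym))
  ... | h′ , Fb , m′ , Fb↠z =
    h′ , _ , proj₁ swapped , Reach-trans (proj₂ swapped) Fb↠z
    where
    swapped = swap-moves m m′ r≢b S-ordinary (¬land-beside E↠S m F↠z m′) (¬jump-over E↠S m F↠z)

-- Compare G(D₃) = G(D₀) ∪ {(a , ca) , (x , cx)} with G(D₃) = G(D₀) ∪ {(b , cb) , (y , cy)}:
-- the added ghosts are not in G(D₀), and (a , ca) ≠ (b , cb).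
second-move-source : ∀ {D₀ D₁ D₂ D₃ a ca â b cb h x cx x̂ y cy ŷ} →
  Move D₀ a ca â D₁ → Move D₀ b cb h D₂ → a ≢ b → Move D₁ x cx x̂ D₃ → Move D₂ y cy ŷ D₃ →
  x ≡ b × cx ≡ cb
second-move-source m₀₁ m₀₂ a≢b m₁₃ m₂₃ with ghost-origin m₂₃ (source-ghost m₁₃)
... | inj₂ D₂-ghost with ghost-origin m₀₂ D₂-ghost
...   | inj₁ same-cell = same-cell
...   | inj₂ D₀-ghost  = ⊥-elim (ordinary≢ghost (trans (sym (isOrdinary m₁₃)) (ghost-preserved m₀₁ D₀-ghost)))
second-move-source m₀₁ m₀₂ a≢b m₁₃ m₂₃ | inj₁ (refl , refl)
  with ghost-origin m₂₃ (ghost-preserved m₁₃ (source-ghost m₀₁))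
... | inj₁ (refl , refl) = ⊥-elim (ordinary≢ghost (trans (sym (isOrdinary m₁₃)) (source-ghost m₀₁)))
... | inj₂ D₂-ghost with ghost-origin m₀₂ D₂-ghost
...   | inj₁ (a≡b , _) = ⊥-elim (a≢b a≡b)
...   | inj₂ D₀-ghost  = ⊥-elim (ordinary≢ghost (trans (sym (isOrdinary m₀₁)) D₀-ghost))

proposition3p8 : (D : RawDiagram) → IsDiagram D → NoGhosts D →
    (D₀ D₁ D₂ D₃ : RawDiagram) →
    D₀ ∈GKD D → D₁ ∈GKD D → D₂ ∈GKD D → D₃ ∈GKD D →
    ¬ (D₁ ≈ D₂) →
    Covers D D₀ D₁ → Covers D D₀ D₂ → Covers D D₁ D₃ → Covers D D₂ D₃ →
    IsMeet D D₁ D₂ D₃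
proposition3p8 D (_ , _ , N , outside) _ D₀ D₁ D₂ D₃ D₀∈ D₁∈ D₂∈ D₃∈ D₁≉D₂ D₀⋗D₁ D₀⋗D₂ D₁⋗D₃ D₂⋗D₃
  with covers⇒Move D₀∈ D₀⋗D₁ | covers⇒Move D₀∈ D₀⋗D₂ | covers⇒Move D₁∈ D₁⋗D₃ | covers⇒Move D₂∈ D₂⋗D₃
... | a , _ , _ , m₀₁ | b , cb , _ , m₀₂ | _ , _ , x̂ , m₁₃ | _ , _ , _ , m₂₃ =
  D₃∈ , proj₁ (proj₁ D₁⋗D₃) , proj₁ (proj₁ D₂⋗D₃) , greatest
  where
  a≢b : a ≢ b
  a≢b refl = D₁≉D₂ (Move-deterministic m₀₁ m₀₂)

  m₁₃-moves-b : Move D₁ b cb x̂ D₃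
  m₁₃-moves-b with second-move-source m₀₁ m₀₂ a≢b m₁₃ m₂₃
  ... | refl , refl = m₁₃

  bounded : Bounded N D₀
  bounded = Bounded-persists D₀∈ λ r c N≤r → outside r c (inj₁ N≤r)

  greatest : ∀ z → z ∈GKD D → z ⪯ D₁ → z ⪯ D₂ → z ⪯ D₃
  greatest z _ z⪯D₁ z⪯D₂
    with ghosting-move-first m₀₂ bounded z⪯D₂ (Move⇒Reach m₀₁) z⪯D₁
           (ordinary-preserved m₀₁ (isOrdinary m₀₂) (a≢b ∘ sym))
  ... | _ , _ , m , S′↠z = Reach-respˡ (Move-deterministic m m₁₃-moves-b) S′↠z
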